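{- If $H$ is an induced subgraph of a graph $G$, then $\mathrm{czf}(H)\le \mathrm{czf}(G)$.
   Context: All graphs are finite and simple. Constrained zero forcing: start with a set $S\subseteq V(G)$ of colored vertices, all others uncolored. A colored vertex $c$ may force an uncolored vertex $u$ to become colored if $u$ is the only uncolored neighbor of $c$; only vertices of the initial set $S$ may ever force. $S$ is a constrained zero forcing set if some sequence of forces colors all vertices. $\mathrm{czf}(G)$ is the minimum size of a constrained zero forcing set (and is $0$ for the graph with no vertices). -}

module Defs where

open import Data.Nat using (ℕ; _≤_)
open import Data.Fin using (Fin)
open import Data.Fin.Subset using (Subset; _∈_; _∉_; ⁅_⁆; _∪_; ⊤; ∣_∣)
open import Data.Bool using (Bool; true; false)
open import Data.Product using (Σ; ∃; _×_)
open import Relation.Binary.PropositionalEquality using (_≡_; _≢_)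
open import Relation.Nullary using (¬_)
open import Function.Definitions using (Injective)

record Graph (n : ℕ) : Set where
  field
    adj   : Fin n → Fin n → Bool
    sym   : ∀ u v → adj u v ≡ adj v u
    irrefl : ∀ v → adj v v ≡ false

open Graph public

Adj : ∀ {n} → Graph n → Fin n → Fin n → Set
Adj G u v = adj G u v ≡ true

data Force {n : ℕ} (G : Graph n) (S : Subset n) (C : Subset n) : Subset n → Set where
  force : (c u : Fin n) → c ∈ S → c ∈ C → u ∉ C → Adj G c u →
          (∀ w → Adj G c w → w ≢ u → w ∈ C) →
          Force G S C (C ∪ ⁅ u ⁆)

data Reach {n : ℕ} (G : Graph n) (S : Subset n) : Subset n → Subset n → Set where
  done : ∀ {C} → Reach G S C C
  step : ∀ {C D E} → Force G S C D → Reach G S D E → Reach G S C E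

IsCZFS : ∀ {n} → Graph n → Subset n → Set
IsCZFS G S = Reach G S S ⊤

IsCzf : ∀ {n} → Graph n → ℕ → Set
IsCzf {n} G k =
  (Σ (Subset n) λ S → IsCZFS G S × ∣ S ∣ ≡ k) ×
  (∀ (S : Subset n) → IsCZFS G S → k ≤ ∣ S ∣)

InducedSubgraph : ∀ {m n} → Graph m → Graph n → Set
InducedSubgraph {m} {n} H G =
  Σ (Fin m → Fin n) λ f → Injective _≡_ _≡_ f × (∀ i j → adj H i j ≡ adj G (f i) (f j))

-- Let S be a constrained zero forcing set of G and f the embedding of H. Replay the
-- forcing process of G inside H: a force c → f w with c = f v in the image is a
-- legal force v → w in H, because H is induced. A force c → f w by a vertex
-- c ∈ S outside the image cannot be replayed, so w is colored from the start
-- instead. After forcing, c has no uncolored neighbour left, so each such c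
-- costs at most one extra vertex, and f⁻¹(S) plus these vertices is a
-- constrained zero forcing set of H of size at most |f⁻¹(S)| + |S ∖ im f| ≤ |S|.
module Submission where

open import Defs hiding (sym)
open import Data.Nat using (ℕ; zero; suc; _≤_; _+_; z≤n; s≤s)
open import Data.Nat.Properties using (≤-trans; ≤-reflexive; +-comm; +-suc; +-monoˡ-≤; +-monoʳ-≤; n≤1+n; module ≤-Reasoning)
open import Data.Fin using (Fin; zero; suc; _≟_)
open import Data.Fin.Properties using (suc-injective)
open import Data.Fin.Subset
open import Data.Fin.Subset.Properties
open import Data.Bool using (true; false)
open import Data.Vec using ([]; _∷_; here; there; lookup; tabulate)
open import Data.Vec.Properties using (lookup∘tabulate; []=⇒lookup; lookup⇒[]=)
open import Data.Product using (Σ; ∃; _×_; _,_; proj₁)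
open import Data.Sum using (_⊎_; inj₁; inj₂; [_,_])
open import Function using (_∘_; id)
open import Function.Definitions using (Injective)
open import Relation.Nullary using (¬_; yes; no)
open import Relation.Nullary.Negation using (contradiction)
open import Relation.Binary.PropositionalEquality using (_≡_; _≢_; refl; sym; trans; cong; subst)

private
  variable
    k l : ℕ

∣p∪q∣≤∣p∣+∣q∣ : (p q : Subset k) → ∣ p ∪ q ∣ ≤ ∣ p ∣ + ∣ q ∣
∣p∪q∣≤∣p∣+∣q∣ []          []          = z≤n
∣p∪q∣≤∣p∣+∣q∣ (true ∷ p)  (true ∷ q)  = s≤s (≤-trans (∣p∪q∣≤∣p∣+∣q∣ p q) (+-monoʳ-≤ ∣ p ∣ (n≤1+n ∣ q ∣)))
∣p∪q∣≤∣p∣+∣q∣ (true ∷ p)  (false ∷ q) = s≤s (∣p∪q∣≤∣p∣+∣q∣ p q)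
∣p∪q∣≤∣p∣+∣q∣ (false ∷ p) (true ∷ q)  = ≤-trans (s≤s (∣p∪q∣≤∣p∣+∣q∣ p q)) (≤-reflexive (sym (+-suc ∣ p ∣ ∣ q ∣)))
∣p∪q∣≤∣p∣+∣q∣ (false ∷ p) (false ∷ q) = ∣p∪q∣≤∣p∣+∣q∣ p q

∣p∩q∣+∣p─q∣≡∣p∣ : (p q : Subset k) → ∣ p ∩ q ∣ + ∣ p ─ q ∣ ≡ ∣ p ∣
∣p∩q∣+∣p─q∣≡∣p∣ []          []          = refl
∣p∩q∣+∣p─q∣≡∣p∣ (true ∷ p)  (true ∷ q)  = cong suc (∣p∩q∣+∣p─q∣≡∣p∣ p q)
∣p∩q∣+∣p─q∣≡∣p∣ (true ∷ p)  (false ∷ q) = trans (+-suc ∣ p ∩ q ∣ ∣ p ─ q ∣) (cong suc (∣p∩q∣+∣p─q∣≡∣p∣ p q))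
∣p∩q∣+∣p─q∣≡∣p∣ (false ∷ p) (true ∷ q)  = ∣p∩q∣+∣p─q∣≡∣p∣ p q
∣p∩q∣+∣p─q∣≡∣p∣ (false ∷ p) (false ∷ q) = ∣p∩q∣+∣p─q∣≡∣p∣ p q

injective⇒∣p∣≤∣q∣ : (g : Fin k → Fin l) → Injective _≡_ _≡_ g →
                    ∀ {p q} → (∀ {x} → x ∈ p → g x ∈ q) → ∣ p ∣ ≤ ∣ q ∣
injective⇒∣p∣≤∣q∣ g g-inj {[]}        into = z≤n
injective⇒∣p∣≤∣q∣ g g-inj {false ∷ p} into =
  injective⇒∣p∣≤∣q∣ (g ∘ suc) (suc-injective ∘ g-inj) (into ∘ there)
injective⇒∣p∣≤∣q∣ g g-inj {true ∷ p} {q} into =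
  ≤-trans (s≤s (injective⇒∣p∣≤∣q∣ (g ∘ suc) (suc-injective ∘ g-inj) into-q-g₀))
          (x∈p⇒∣p-x∣<∣p∣ (into here))
  where
  into-q-g₀ : ∀ {x} → x ∈ p → g (suc x) ∈ q - g zero
  into-q-g₀ x∈p = x∈p∧x≢y⇒x∈p-y (into (there x∈p)) (λ e → contradiction (g-inj e) λ ())

∣p∪⁅x⁆∣≤1+∣p∣ : (p : Subset k) (x : Fin k) → ∣ p ∪ ⁅ x ⁆ ∣ ≤ suc ∣ p ∣
∣p∪⁅x⁆∣≤1+∣p∣ p x = begin
  ∣ p ∪ ⁅ x ⁆ ∣      ≤⟨ ∣p∪q∣≤∣p∣+∣q∣ p ⁅ x ⁆ ⟩
  ∣ p ∣ + ∣ ⁅ x ⁆ ∣  ≡⟨ cong (∣ p ∣ +_) (∣⁅x⁆∣≡1 x) ⟩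
  ∣ p ∣ + 1          ≡⟨ +-comm ∣ p ∣ 1 ⟩
  suc ∣ p ∣          ∎
  where open ≤-Reasoning

p⊆r∧q⊆r⇒p∪q⊆r : {p q r : Subset k} → p ⊆ r → q ⊆ r → p ∪ q ⊆ r
p⊆r∧q⊆r⇒p∪q⊆r {p = p} {q} p⊆r q⊆r x∈ = [ p⊆r , q⊆r ] (x∈p∪q⁻ p q x∈)

x∈p⇒⁅x⁆⊆p : {x : Fin k} {p : Subset k} → x ∈ p → ⁅ x ⁆ ⊆ p
x∈p⇒⁅x⁆⊆p {x = x} {p} x∈p y∈ = subst (_∈ p) (sym (x∈⁅y⁆⇒x≡y x y∈)) x∈p

p⊆q⇒p∪r⊆q∪r : {p q r : Subset k} → p ⊆ q → p ∪ r ⊆ q ∪ r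
p⊆q⇒p∪r⊆q∪r {q = q} {r} p⊆q = p⊆r∧q⊆r⇒p∪q⊆r (p⊆p∪q r ∘ p⊆q) (q⊆p∪q q r)

p⊆q∪s⇒p∪r⊆q∪r∪s : {p q r s : Subset k} → p ⊆ q ∪ s → p ∪ r ⊆ (q ∪ r) ∪ s
p⊆q∪s⇒p∪r⊆q∪r∪s {q = q} {r} {s} p⊆q∪s =
  p⊆r∧q⊆r⇒p∪q⊆r (p⊆q⇒p∪r⊆q∪r (p⊆p∪q r) ∘ p⊆q∪s) (p⊆p∪q s ∘ q⊆p∪q q r)

image : (Fin k → Fin l) → Subset l
image {zero}  f = ⊥
image {suc k} f = ⁅ f zero ⁆ ∪ image (f ∘ suc)

f∈image : (f : Fin k → Fin l) (i : Fin k) → f i ∈ image f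
f∈image f zero    = p⊆p∪q (image (f ∘ suc)) (x∈⁅x⁆ (f zero))
f∈image f (suc i) = q⊆p∪q ⁅ f zero ⁆ (image (f ∘ suc)) (f∈image (f ∘ suc) i)

∈image⇒∃ : (f : Fin k → Fin l) {y : Fin l} → y ∈ image f → ∃ λ i → f i ≡ y
∈image⇒∃ {zero}  f y∈ = contradiction y∈ ∉⊥
∈image⇒∃ {suc k} f y∈ with x∈p∪q⁻ ⁅ f zero ⁆ (image (f ∘ suc)) y∈
... | inj₁ y∈⁅f₀⁆ = zero , sym (x∈⁅y⁆⇒x≡y (f zero) y∈⁅f₀⁆)
... | inj₂ y∈im   with ∈image⇒∃ (f ∘ suc) y∈im
...   | i , fsi≡y = suc i , fsi≡y

∃-preimage⊎∉image : (f : Fin k → Fin l) (y : Fin l) → (∃ λ i → f i ≡ y) ⊎ y ∉ image f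
∃-preimage⊎∉image f y with y ∈? image f
... | yes y∈im = inj₁ (∈image⇒∃ f y∈im)
... | no  y∉im = inj₂ y∉im

preimage : (Fin k → Fin l) → Subset l → Subset k
preimage f C = tabulate (λ i → lookup C (f i))

module _ (f : Fin k → Fin l) where

  ∈preimage⁻ : ∀ {C x} → x ∈ preimage f C → f x ∈ C
  ∈preimage⁻ {C} {x} x∈ =
    lookup⇒[]= (f x) C (trans (sym (lookup∘tabulate (λ i → lookup C (f i)) x)) ([]=⇒lookup x∈))

  ∈preimage⁺ : ∀ {C x} → f x ∈ C → x ∈ preimage f C
  ∈preimage⁺ {C} {x} fx∈ =
    lookup⇒[]= x (preimage f C) (trans (lookup∘tabulate (λ i → lookup C (f i)) x) ([]=⇒lookup fx∈))

  preimage-∪-∉image : ∀ C {u} → u ∉ image f → preimage f (C ∪ ⁅ u ⁆) ⊆ preimage f C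
  preimage-∪-∉image C {u} u∉im {x} x∈ =
    ∈preimage⁺ {C} ([ id , (λ fx∈⁅u⁆ → contradiction (subst (_∈ image f) (x∈⁅y⁆⇒x≡y u fx∈⁅u⁆) (f∈image f x)) u∉im) ]
                    (x∈p∪q⁻ C ⁅ u ⁆ (∈preimage⁻ {C ∪ ⁅ u ⁆} x∈)))

  preimage-∪-⁅f⁆ : Injective _≡_ _≡_ f → ∀ C {w} → preimage f (C ∪ ⁅ f w ⁆) ⊆ preimage f C ∪ ⁅ w ⁆
  preimage-∪-⁅f⁆ f-inj C {w} {x} x∈ =
    [ p⊆p∪q ⁅ w ⁆ ∘ ∈preimage⁺ {C}
    , (λ fx∈⁅fw⁆ → q⊆p∪q (preimage f C) ⁅ w ⁆ (subst (_∈ ⁅ w ⁆) (sym (f-inj (x∈⁅y⁆⇒x≡y (f w) fx∈⁅fw⁆))) (x∈⁅x⁆ w)))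
    ] (x∈p∪q⁻ C ⁅ f w ⁆ (∈preimage⁻ {C ∪ ⁅ f w ⁆} x∈))

  ∣preimage∣+∣p─image∣≤∣p∣ : Injective _≡_ _≡_ f → ∀ C → ∣ preimage f C ∣ + ∣ C ─ image f ∣ ≤ ∣ C ∣
  ∣preimage∣+∣p─image∣≤∣p∣ f-inj C = ≤-trans
    (+-monoˡ-≤ ∣ C ─ image f ∣ (injective⇒∣p∣≤∣q∣ f f-inj (λ {x} x∈ → x∈p∩q⁺ (∈preimage⁻ {C} x∈ , f∈image f x))))
    (≤-reflexive (∣p∩q∣+∣p─q∣≡∣p∣ C (image f)))

module _ {G : Graph k} where

  Reach-mono-forcers : ∀ {T T' D E} → T ⊆ T' → Reach G T D E → Reach G T' D E
  Reach-mono-forcers T⊆T' done = done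
  Reach-mono-forcers T⊆T' (step (force c u c∈T c∈C u∉C cu others) r) =
    step (force c u (T⊆T' c∈T) c∈C u∉C cu others) (Reach-mono-forcers T⊆T' r)

  -- Forces whose target is already colored are skipped.
  Reach⊤-mono : ∀ {T D D'} → D ⊆ D' → Reach G T D ⊤ → Reach G T D' ⊤
  Reach⊤-mono {T} {D' = D'} D⊆D' done =
    subst (λ E → Reach G T E ⊤) (sym (⊆-antisym ⊆⊤ D⊆D')) done
  Reach⊤-mono {D' = D'} D⊆D' (step (force c u c∈T c∈D u∉D cu others) r) with u ∈? D'
  ... | yes u∈D' = Reach⊤-mono (p⊆r∧q⊆r⇒p∪q⊆r D⊆D' (x∈p⇒⁅x⁆⊆p u∈D')) r
  ... | no  u∉D' = step (force c u c∈T (D⊆D' c∈D) u∉D' cu (λ w cw w≢u → D⊆D' (others w cw w≢u)))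
                        (Reach⊤-mono (p⊆q⇒p∪r⊆q∪r D⊆D') r)

  Reach⊤-force : ∀ {T D c u} → c ∈ T → c ∈ D → Adj G c u → (∀ w → Adj G c w → w ≢ u → w ∈ D) →
                 Reach G T (D ∪ ⁅ u ⁆) ⊤ → Reach G T D ⊤
  Reach⊤-force {D = D} {u = u} c∈T c∈D cu others r with u ∈? D
  ... | yes u∈D = Reach⊤-mono (p⊆r∧q⊆r⇒p∪q⊆r id (x∈p⇒⁅x⁆⊆p u∈D)) r
  ... | no  u∉D = step (force _ u c∈T c∈D u∉D cu others) r

  forcer-saturated : ∀ {C c u} → (∀ w → Adj G c w → w ≢ u → w ∈ C) →
                     ∀ w → Adj G c w → w ∈ C ∪ ⁅ u ⁆
  forcer-saturated {C} {u = u} others w cw with w ≟ u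
  ... | yes refl = q⊆p∪q C ⁅ u ⁆ (x∈⁅x⁆ u)
  ... | no  w≢u  = p⊆p∪q ⁅ u ⁆ (others w cw w≢u)

module Restrict {m n} (H : Graph m) (G : Graph n) (f : Fin m → Fin n) (f-inj : Injective _≡_ _≡_ f)
                (f-adj : ∀ i j → adj H i j ≡ adj G (f i) (f j)) (S : Subset n) where

  Sᴴ : Subset m
  Sᴴ = preimage f S

  Active : Subset n → Fin n → Set
  Active C c = c ∈ S ─ image f × ∃ λ w → Adj G c w × w ∉ C

  Active-∪ : ∀ {C u c} → Active (C ∪ ⁅ u ⁆) c → Active C c
  Active-∪ {C} {u} (c∈ , w , cw , w∉) = c∈ , w , cw , w∉ ∘ p⊆p∪q ⁅ u ⁆

  -- B contains the forcers of S outside the image that have not forced yet;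
  -- each of them adds at most one vertex to X.
  replay : ∀ {C} → Reach G S C ⊤ → (B : Subset n) → (∀ {c} → Active C c → c ∈ B) →
         Σ (Subset m) λ X → Reach H Sᴴ (preimage f C ∪ X) ⊤ × ∣ X ∣ ≤ ∣ B ∣
  replay done B _ =
    ⊥ , Reach⊤-mono (λ _ → p⊆p∪q ⊥ (∈preimage⁺ f ∈⊤)) done , ≤-trans (≤-reflexive (∣⊥∣≡0 m)) z≤n
  replay {C} (step (force c u c∈S c∈C u∉C cu others) r) B B⊇active with ∃-preimage⊎∉image f u | ∃-preimage⊎∉image f c
  ... | inj₂ u∉im | _ =
    let X , R , ∣X∣≤ = replay r B (B⊇active ∘ Active-∪)
    in X , Reach⊤-mono (p⊆q⇒p∪r⊆q∪r (preimage-∪-∉image f C u∉im)) R , ∣X∣≤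
  ... | inj₁ (w , refl) | inj₁ (v , refl) =
    let X , R , ∣X∣≤ = replay r B (B⊇active ∘ Active-∪)
    in X , Reach⊤-force (∈preimage⁺ f c∈S) (p⊆p∪q X (∈preimage⁺ f c∈C)) (trans (f-adj v w) cu)
                        (others-colored X)
                        (Reach⊤-mono (p⊆q∪s⇒p∪r⊆q∪r∪s (preimage-∪-⁅f⁆ f f-inj C)) R)
         , ∣X∣≤
    where
    others-colored : ∀ X w' → Adj H v w' → w' ≢ w → w' ∈ preimage f C ∪ X
    others-colored X w' vw' w'≢w =
      p⊆p∪q X (∈preimage⁺ f (others (f w') (trans (sym (f-adj v w')) vw') (w'≢w ∘ f-inj)))
  ... | inj₁ (w , refl) | inj₂ c∉im =
    let X , R , ∣X∣≤ = replay r (B - c) B-c⊇active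
    in X ∪ ⁅ w ⁆
       , Reach⊤-mono (⊆-trans (p⊆q∪s⇒p∪r⊆q∪r∪s (preimage-∪-⁅f⁆ f f-inj C))
                              (⊆-reflexive (∪-assoc (preimage f C) X ⁅ w ⁆))) R
       , ≤-trans (∣p∪⁅x⁆∣≤1+∣p∣ X w) (≤-trans (s≤s ∣X∣≤) (x∈p⇒∣p-x∣<∣p∣ c∈B))
    where
    c∈B : c ∈ B
    c∈B = B⊇active (x∈p∧x∉q⇒x∈p─q c∈S c∉im , f w , cu , u∉C)

    c-inactive : ¬ Active (C ∪ ⁅ f w ⁆) c
    c-inactive (_ , y , cy , y∉) = y∉ (forcer-saturated {G = G} others y cy)

    B-c⊇active : ∀ {c'} → Active (C ∪ ⁅ f w ⁆) c' → c' ∈ B - c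
    B-c⊇active a = x∈p∧x≢y⇒x∈p-y (B⊇active (Active-∪ {C} a)) λ { refl → c-inactive a }

  restrict-czfs : IsCZFS G S → Σ (Subset m) λ S' → IsCZFS H S' × ∣ S' ∣ ≤ ∣ S ∣
  restrict-czfs S-czfs =
    let X , R , ∣X∣≤ = replay S-czfs (S ─ image f) proj₁
    in Sᴴ ∪ X , Reach-mono-forcers (p⊆p∪q X) R , (begin
      ∣ Sᴴ ∪ X ∣                  ≤⟨ ∣p∪q∣≤∣p∣+∣q∣ Sᴴ X ⟩
      ∣ Sᴴ ∣ + ∣ X ∣              ≤⟨ +-monoʳ-≤ ∣ Sᴴ ∣ ∣X∣≤ ⟩
      ∣ Sᴴ ∣ + ∣ S ─ image f ∣    ≤⟨ ∣preimage∣+∣p─image∣≤∣p∣ f f-inj S ⟩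
      ∣ S ∣                       ∎)
    where open ≤-Reasoning

mainTheorem5 : ∀ {m n} (H : Graph m) (G : Graph n) → InducedSubgraph H G →
    ∀ (kH kG : ℕ) → IsCzf H kH → IsCzf G kG → kH ≤ kG
mainTheorem5 H G (f , f-inj , f-adj) kH kG (_ , kH-least) ((S , S-czfs , refl) , _) =
  let S' , S'-czfs , ∣S'∣≤∣S∣ = Restrict.restrict-czfs H G f f-inj f-adj S S-czfs
  in ≤-trans (kH-least S' S'-czfs) ∣S'∣≤∣S∣
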